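{- Let $(a,b,c)$ be a triple of positive integers with $a=b+c-1$, $a\geq c\geq b$, and $b$ and $c$ relatively prime. Then $(a,b,c)$ is a good triple.
   Context: For positive integers $a,b,c$ with $n=a+b+c$, the permutation of the triple $(a,b,c)$ is the permutation of $[n]$ with $p_i=n+1-i$ for $1\le i\le a$, $p_i=a+b+1-i$ for $a+1\le i\le a+b$, and $p_i=n+b+1-i$ for $a+b+1\le i\le n$ (one-line notation $n\cdots(n-a+1)\ b\cdots1\ (b+c)\cdots(b+1)$). The triple is good if this permutation, as a bijection $i\mapsto p_i$ of $[n]$, is a single $n$-cycle. -}

module Defs where

open import Data.Nat using (ℕ; zero; suc; _+_; _∸_; _≤_; _<_; _≤ᵇ_)
open import Data.Bool using (if_then_else_)
open import Data.Product using (∃; _×_)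
open import Relation.Binary.PropositionalEquality using (_≡_)

-- The permutation of the triple (a,b,c), n = a+b+c, as a function on ℕ
-- (1-indexed; meaningful on [n] = {1,…,n}):
--   p i = n+1-i      for 1 ≤ i ≤ a
--   p i = a+b+1-i    for a+1 ≤ i ≤ a+b
--   p i = n+b+1-i    for a+b+1 ≤ i ≤ n
tripleperm : ℕ → ℕ → ℕ → ℕ → ℕ
tripleperm a b c i =
  if i ≤ᵇ a then (a + b + c + 1) ∸ i
  else if i ≤ᵇ a + b then (a + b + 1) ∸ i
  else (a + b + c + b + 1) ∸ i

iter : (ℕ → ℕ) → ℕ → ℕ → ℕ
iter f zero x = x
iter f (suc k) x = f (iter f k x)

-- A permutation f of [n] = {1,…,n} is a single n-cycle iff it has exactly one
-- orbit on [n]: every j ∈ [n] is reached from every i ∈ [n] by iterating f.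
IsSingleCycle : ℕ → (ℕ → ℕ) → Set
IsSingleCycle n f =
  ∀ i j → 1 ≤ i → i ≤ n → 1 ≤ j → j ≤ n → ∃ λ k → iter f k i ≡ j

Good : ℕ → ℕ → ℕ → Set
Good a b c = IsSingleCycle (a + b + c) (tripleperm a b c)

-- Put N = b + c = a + 1, so n = a + b + c = a + N, and let f be the
-- permutation of the triple.  We study f through the window W = [1..N]:
--   * every point of [1..n] outside W is sent into W by one step of f, and is
--     the image of a point of W ('window-entered', 'window-left');
--   * the first return of f to W is the rotation  rot b c : s ↦ s + b (mod N)
--     of W: for s ≤ c the orbit runs s ↦ n+1-s ↦ s+b, for c < s < N it runs
--     s ↦ n+1-s ↦ s-c, and N ↦ b ('first-return');
--   * as gcd(b,N) = gcd(b,c) = 1, b is invertible modulo N, so the rotation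
--     by b is transitive on W ('rot-transitive').
module Submission where

open import Defs
open import Data.Nat using (ℕ; _+_; _∸_; _≤_; _<_)
open import Data.Nat.Coprimality using (Coprime)
open import Relation.Binary.PropositionalEquality using (_≡_)

open import Data.Nat using (zero; suc; _*_; _≤ᵇ_; _≤?_; _%_; NonZero; z≤n; s≤s)
open import Data.Nat.Properties
  using ( +-suc; +-comm; +-assoc; +-identityʳ; *-assoc; *-identityʳ; +-cancelʳ-≡; +-cancelˡ-≤
        ; +-monoˡ-≤; +-monoʳ-≤; ≤-trans; ≤-reflexive; <-trans; ≤-<-trans; <⇒≱; ≰⇒>
        ; n≤1+n; n<1+n; m≤m+n; m≤n+m; m+n∸m≡n; m+[n∸m]≡n
        ; m≤n⇒m<n∨m≡n; m≤n⇒∃[o]m+o≡n; ≤ᵇ⇒≤; ≤⇒≤ᵇ; module ≤-Reasoning )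
open import Data.Nat.DivMod using (%-distribˡ-+; %-distribˡ-*; [m+n]%n≡m%n; [m+kn]%n≡m%n; n%n≡0; m<n⇒m%n≡m)
open import Data.Nat.Coprimality using (coprime-Bézout; coprime-+)
open import Data.Nat.GCD using (module Bézout)
import Data.Nat.Coprimality as Coprimality
open import Data.Nat.Tactic.RingSolver using (solve)
open import Data.Bool using (true; false; T; if_then_else_)
open import Data.Unit using (tt)
open import Data.Empty using (⊥-elim)
open import Data.Sum using (_⊎_; inj₁; inj₂)
open import Data.Product using (∃; _×_; _,_)
open import Data.List using (_∷_; [])
open import Function using (_∘_)
open import Relation.Nullary using (¬_; yes; no)
open import Relation.Binary.PropositionalEquality using (refl; sym; trans; cong; subst; module ≡-Reasoning)

if-holds : ∀ {A : Set} {x y : A} b → T b → (if b then x else y) ≡ x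
if-holds true _ = refl

if-fails : ∀ {A : Set} {x y : A} b → ¬ T b → (if b then x else y) ≡ y
if-fails false _ = refl
if-fails true ¬tt = ⊥-elim (¬tt tt)

∸-by-sum : ∀ {i t m} → i + t ≡ m → m ∸ i ≡ t
∸-by-sum {i} {t} refl = m+n∸m≡n i t

≤-by-sum : ∀ {x y} k → x + k ≡ y → x ≤ y
≤-by-sum {x} k refl = m≤m+n x k

gap : ∀ {m i e k} → m < i → i + e ≡ m + k → suc e ≤ k
gap {m} {i} {e} {k} m<i eq = +-cancelˡ-≤ m (suc e) k (begin
    m + suc e ≡⟨ +-suc m e ⟩
    suc m + e ≤⟨ +-monoˡ-≤ e m<i ⟩
    i + e     ≡⟨ eq ⟩
    m + k     ∎)
  where open ≤-Reasoning

≤-or-above : ∀ s c → s ≤ c ⊎ ∃ λ k → c + suc k ≡ s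
≤-or-above s c with s ≤? c
... | yes s≤c = inj₁ s≤c
... | no s≰c with m≤n⇒∃[o]m+o≡n (≰⇒> s≰c)
...   | k , eq = inj₂ (k , trans (+-suc c k) eq)

InRange : ℕ → ℕ → Set
InRange N s = 1 ≤ s × s ≤ N

Reaches : (ℕ → ℕ) → ℕ → ℕ → Set
Reaches f i j = ∃ λ k → iter f k i ≡ j

iter-+ : ∀ f k m x → iter f (k + m) x ≡ iter f k (iter f m x)
iter-+ f zero m x = refl
iter-+ f (suc k) m x = cong f (iter-+ f k m x)

reaches-refl : ∀ f i → Reaches f i i
reaches-refl f i = 0 , refl

reaches-step : ∀ f i → Reaches f i (f i)
reaches-step f i = 1 , refl

reaches-trans : ∀ f {i j l} → Reaches f i j → Reaches f j l → Reaches f i l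
reaches-trans f {i} (m , refl) (k , refl) = k + m , iter-+ f k m i

iter-preserves : ∀ (R : ℕ → ℕ) (S : ℕ → Set) → (∀ s → S s → S (R s)) →
                 ∀ m s → S s → S (iter R m s)
iter-preserves R S R-preserves zero s s∈S = s∈S
iter-preserves R S R-preserves (suc m) s s∈S =
  R-preserves _ (iter-preserves R S R-preserves m s s∈S)

module Simulation (f R : ℕ → ℕ) (S : ℕ → Set)
                  (R-preserves : ∀ s → S s → S (R s))
                  (f-reaches-R : ∀ s → S s → Reaches f s (R s)) where

  iter-reached : ∀ m s → S s → Reaches f s (iter R m s)
  iter-reached zero s s∈S = reaches-refl f s
  iter-reached (suc m) s s∈S =
    reaches-trans f (iter-reached m s s∈S)
                    (f-reaches-R _ (iter-preserves R S R-preserves m s s∈S))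

  simulate : ∀ s t → S s → Reaches R s t → Reaches f s t
  simulate s _ s∈S (m , refl) = iter-reached m s s∈S

single-cycle-criterion : ∀ n f (S : ℕ → Set) →
  (∀ i → 1 ≤ i → i ≤ n → ∃ λ s → S s × Reaches f i s) →
  (∀ j → 1 ≤ j → j ≤ n → ∃ λ s → S s × Reaches f s j) →
  (∀ s t → S s → S t → Reaches f s t) →
  IsSingleCycle n f
single-cycle-criterion n f S enter leave connected i j 1≤i i≤n 1≤j j≤n =
  let (s , s∈S , i⇝s) = enter i 1≤i i≤n
      (t , t∈S , t⇝j) = leave j 1≤j j≤n
  in reaches-trans f i⇝s (reaches-trans f (connected s t s∈S t∈S) t⇝j)

-- Reduction modulo N is injective on [1..N] (N itself plays the role of 0).
range-mod-injective : ∀ {N s t} .{{_ : NonZero N}} →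
  InRange N s → InRange N t → s % N ≡ t % N → s ≡ t
range-mod-injective {N} {s} {t} (1≤s , s≤N) (1≤t , t≤N) eq
  with m≤n⇒m<n∨m≡n s≤N | m≤n⇒m<n∨m≡n t≤N
... | inj₁ s<N | inj₁ t<N = trans (sym (m<n⇒m%n≡m s<N)) (trans eq (m<n⇒m%n≡m t<N))
... | inj₁ s<N | inj₂ refl =
  ⊥-elim (<⇒≱ 1≤s (≤-reflexive (trans (sym (m<n⇒m%n≡m s<N)) (trans eq (n%n≡0 N)))))
... | inj₂ refl | inj₁ t<N =
  ⊥-elim (<⇒≱ 1≤t (≤-reflexive (trans (sym (m<n⇒m%n≡m t<N)) (trans (sym eq) (n%n≡0 N)))))
... | inj₂ refl | inj₂ refl = refl

%-cong-+ʳ : ∀ x y z N .{{_ : NonZero N}} → x % N ≡ y % N → (x + z) % N ≡ (y + z) % N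
%-cong-+ʳ x y z N eq = begin
    (x + z) % N             ≡⟨ %-distribˡ-+ x z N ⟩
    (x % N + z % N) % N     ≡⟨ cong (λ v → (v + z % N) % N) eq ⟩
    (y % N + z % N) % N     ≡⟨ %-distribˡ-+ y z N ⟨
    (y + z) % N             ∎
  where open ≡-Reasoning

%-cong-+ˡ : ∀ x y z N .{{_ : NonZero N}} → x % N ≡ y % N → (z + x) % N ≡ (z + y) % N
%-cong-+ˡ x y z N eq =
  trans (cong (_% N) (+-comm z x)) (trans (%-cong-+ʳ x y z N eq) (cong (_% N) (+-comm y z)))

modular-inverse : ∀ {m} n → Coprime m (suc n) → ∃ λ u → (u * m) % suc n ≡ 1 % suc n
modular-inverse {m} n cop with coprime-Bézout cop
... | Bézout.+- x y eq = x , (begin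
    (x * m) % suc n         ≡⟨ cong (_% suc n) eq ⟨
    (1 + y * suc n) % suc n ≡⟨ [m+kn]%n≡m%n 1 y (suc n) ⟩
    1 % suc n               ∎)
  where open ≡-Reasoning
-- Here x * m ≡ -1, so x * n ≡ x * (N - 1) is an inverse.
... | Bézout.-+ x y eq = x * n , (begin
    (x * n * m) % suc n             ≡⟨ [m+n]%n≡m%n (x * n * m) (suc n) ⟨
    (x * n * m + suc n) % suc n     ≡⟨ cong (_% suc n) shifted ⟩
    (1 + n * y * suc n) % suc n     ≡⟨ [m+kn]%n≡m%n 1 (n * y) (suc n) ⟩
    1 % suc n                       ∎)
  where
  open ≡-Reasoning
  shifted : x * n * m + suc n ≡ 1 + n * y * suc n
  shifted = begin
    x * n * m + suc n     ≡⟨ solve (x ∷ n ∷ m ∷ []) ⟩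
    1 + n * (1 + x * m)   ≡⟨ cong (λ v → 1 + n * v) eq ⟩
    1 + n * (y * suc n)   ≡⟨ solve (n ∷ y ∷ []) ⟩
    1 + n * y * suc n     ∎

multiples-cover : ∀ {m} n → Coprime m (suc n) → ∀ k → ∃ λ v → (v * m) % suc n ≡ k % suc n
multiples-cover {m} n cop k with modular-inverse n cop
... | u , um≡1 = k * u , (begin
    (k * u * m) % N                 ≡⟨ cong (_% N) (*-assoc k u m) ⟩
    (k * (u * m)) % N               ≡⟨ %-distribˡ-* k (u * m) N ⟩
    (k % N * ((u * m) % N)) % N     ≡⟨ cong (λ v → (k % N * v) % N) um≡1 ⟩
    (k % N * (1 % N)) % N           ≡⟨ %-distribˡ-* k 1 N ⟨
    (k * 1) % N                     ≡⟨ cong (_% N) (*-identityʳ k) ⟩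
    k % N                           ∎)
  where
  open ≡-Reasoning
  N : ℕ
  N = suc n

-- s ↦ s + b on [1..c] and s ↦ s - c on [c+1..b+c]: the map s ↦ s + b
-- (mod b + c) on the representatives [1..b + c].
rot : ℕ → ℕ → ℕ → ℕ
rot b c s = if s ≤ᵇ c then s + b else s ∸ c

rot-low : ∀ {b c s} → s ≤ c → rot b c s ≡ s + b
rot-low {c = c} {s} s≤c = if-holds (s ≤ᵇ c) (≤⇒≤ᵇ s≤c)

rot-high : ∀ b c k → rot b c (c + suc k) ≡ suc k
rot-high b c k =
  trans (if-fails (c + suc k ≤ᵇ c) (<⇒≱ c<s ∘ ≤ᵇ⇒≤ (c + suc k) c)) (m+n∸m≡n c (suc k))
  where
  c<s : c < c + suc k
  c<s = ≤-by-sum k (sym (+-suc c k))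

rot-top : ∀ b' c → rot (suc b') c (suc b' + c) ≡ suc b'
rot-top b' c = trans (cong (rot (suc b') c) (+-comm (suc b') c)) (rot-high (suc b') c b')

module Rotation {a b c : ℕ} (N≡b+c : suc a ≡ b + c) where

  rot-range : ∀ s → InRange (suc a) s → InRange (suc a) (rot b c s)
  rot-range s (1≤s , s≤N) with ≤-or-above s c
  ... | inj₁ s≤c rewrite rot-low {b} s≤c =
    ≤-trans 1≤s (m≤m+n s b) ,
    ≤-trans (+-monoˡ-≤ b s≤c) (≤-reflexive (trans (+-comm c b) (sym N≡b+c)))
  ... | inj₂ (k , refl) rewrite rot-high b c k = s≤s z≤n , ≤-trans (m≤n+m (suc k) c) s≤N

  rot-mod : ∀ s → rot b c s % suc a ≡ (s + b) % suc a
  rot-mod s with ≤-or-above s c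
  ... | inj₁ s≤c = cong (_% suc a) (rot-low s≤c)
  ... | inj₂ (k , refl) = begin
      rot b c (c + suc k) % suc a   ≡⟨ cong (_% suc a) (rot-high b c k) ⟩
      suc k % suc a                 ≡⟨ [m+n]%n≡m%n (suc k) (suc a) ⟨
      (suc k + suc a) % suc a       ≡⟨ cong (_% suc a) wrap ⟩
      (c + suc k + b) % suc a       ∎
    where
    open ≡-Reasoning
    wrap : suc k + suc a ≡ c + suc k + b
    wrap = trans (cong (suc k +_) N≡b+c) (solve (k ∷ b ∷ c ∷ []))

  iter-rot-mod : ∀ m s → iter (rot b c) m s % suc a ≡ (s + m * b) % suc a
  iter-rot-mod zero s = cong (_% suc a) (sym (+-identityʳ s))
  iter-rot-mod (suc m) s = begin
      rot b c (iter (rot b c) m s) % suc a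
        ≡⟨ rot-mod (iter (rot b c) m s) ⟩
      (iter (rot b c) m s + b) % suc a
        ≡⟨ %-cong-+ʳ (iter (rot b c) m s) (s + m * b) b (suc a) (iter-rot-mod m s) ⟩
      (s + m * b + b) % suc a
        ≡⟨ cong (_% suc a) regroup ⟩
      (s + suc m * b) % suc a ∎
    where
    open ≡-Reasoning
    regroup : s + m * b + b ≡ s + suc m * b
    regroup = solve (s ∷ m ∷ b ∷ [])

  -- gcd(b, b + c) = gcd(b, c).
  coprime-to-window : Coprime b c → Coprime b (suc a)
  coprime-to-window cop =
    subst (Coprime b) (sym N≡b+c) (Coprimality.sym (coprime-+ (Coprimality.sym cop)))

  -- To go from s to t, rotate m times where m * b ≡ t - s (mod N).
  rot-transitive : Coprime b c → ∀ s t → InRange (suc a) s → InRange (suc a) t →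
                   Reaches (rot b c) s t
  rot-transitive cop s t s∈@(_ , s≤N) t∈
    with multiples-cover a (coprime-to-window cop) (t + (suc a ∸ s))
  ... | m , m*b≡t-s = m , range-mod-injective end∈ t∈ (begin
      iter (rot b c) m s % suc a
        ≡⟨ iter-rot-mod m s ⟩
      (s + m * b) % suc a
        ≡⟨ %-cong-+ˡ (m * b) (t + (suc a ∸ s)) s (suc a) m*b≡t-s ⟩
      (s + (t + (suc a ∸ s))) % suc a
        ≡⟨ cong (_% suc a) s+[t-s]≡t+N ⟩
      (t + suc a) % suc a
        ≡⟨ [m+n]%n≡m%n t (suc a) ⟩
      t % suc a ∎)
    where
    open ≡-Reasoning
    end∈ : InRange (suc a) (iter (rot b c) m s)
    end∈ = iter-preserves (rot b c) (InRange (suc a)) rot-range m s s∈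
    s+[t-s]≡t+N : s + (t + (suc a ∸ s)) ≡ t + suc a
    s+[t-s]≡t+N = begin
      s + (t + (suc a ∸ s))   ≡⟨ cong (s +_) (+-comm t (suc a ∸ s)) ⟩
      s + ((suc a ∸ s) + t)   ≡⟨ +-assoc s (suc a ∸ s) t ⟨
      s + (suc a ∸ s) + t     ≡⟨ cong (_+ t) (m+[n∸m]≡n s≤N) ⟩
      suc a + t               ≡⟨ +-comm (suc a) t ⟩
      t + suc a               ∎

perm-first : ∀ a b c {i t} → i ≤ a → i + t ≡ a + b + c + 1 → tripleperm a b c i ≡ t
perm-first a b c {i} i≤a eq = trans (if-holds (i ≤ᵇ a) (≤⇒≤ᵇ i≤a)) (∸-by-sum eq)

perm-middle : ∀ a b c {i t} → a < i → i ≤ a + b → i + t ≡ a + b + 1 → tripleperm a b c i ≡ t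
perm-middle a b c {i} a<i i≤a+b eq =
  trans (if-fails (i ≤ᵇ a) (<⇒≱ a<i ∘ ≤ᵇ⇒≤ i a))
        (trans (if-holds (i ≤ᵇ a + b) (≤⇒≤ᵇ i≤a+b)) (∸-by-sum eq))

perm-last : ∀ a b c {i t} → a + b < i → i + t ≡ a + b + c + b + 1 → tripleperm a b c i ≡ t
perm-last a b c {i} a+b<i eq =
  trans (if-fails (i ≤ᵇ a) (<⇒≱ (≤-<-trans (m≤m+n a b) a+b<i) ∘ ≤ᵇ⇒≤ i a))
        (trans (if-fails (i ≤ᵇ a + b) (<⇒≱ a+b<i ∘ ≤ᵇ⇒≤ i (a + b))) (∸-by-sum eq))

middle-lands : ∀ {a b c i} → a < i → i ≤ a + b → InRange b (tripleperm a b c i)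
middle-lands {a} {b} {c} {i} a<i i≤a+b with m≤n⇒∃[o]m+o≡n i≤a+b
... | e , i+e≡a+b = subst (InRange b) (sym f-i≡1+e) (s≤s z≤n , gap a<i i+e≡a+b)
  where
  f-i≡1+e : tripleperm a b c i ≡ suc e
  f-i≡1+e = perm-middle a b c a<i i≤a+b
    (trans (+-suc i e) (trans (cong suc i+e≡a+b) (+-comm 1 (a + b))))

last-lands : ∀ {a b c i} → a + b < i → i ≤ a + b + c →
             b < tripleperm a b c i × tripleperm a b c i ≤ b + c
last-lands {a} {b} {c} {i} a+b<i i≤n with m≤n⇒∃[o]m+o≡n i≤n
... | r , i+r≡n = subst (λ x → b < x × x ≤ b + c) (sym f-i≡b+1+r)
                    (≤-by-sum r (sym (+-suc b r)) , +-monoʳ-≤ b (gap a+b<i i+r≡n))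
  where
  f-i≡b+1+r : tripleperm a b c i ≡ b + suc r
  f-i≡b+1+r = perm-last a b c a+b<i (trans regroup (cong (λ n → n + b + 1) i+r≡n))
    where
    regroup : i + (b + suc r) ≡ i + r + b + 1
    regroup = solve (i ∷ r ∷ b ∷ [])

tail-lands : ∀ {a b c i} → a < i → i ≤ a + b + c → InRange (b + c) (tripleperm a b c i)
tail-lands {a} {b} {c} {i} a<i i≤n with i ≤? a + b
... | yes i≤a+b = let (1≤fi , fi≤b) = middle-lands {c = c} a<i i≤a+b
                  in 1≤fi , ≤-trans fi≤b (m≤m+n b c)
... | no i≰a+b = let (b<fi , fi≤b+c) = last-lands (≰⇒> i≰a+b) i≤n
                 in ≤-trans (s≤s z≤n) b<fi , fi≤b+c

head-covers : ∀ {a b c j} → b + c < j → j ≤ a + b + c →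
              ∃ λ s → (1 ≤ s × s ≤ a) × tripleperm a b c s ≡ j
head-covers {a} {b} {c} {j} b+c<j j≤n with m≤n⇒∃[o]m+o≡n j≤n
... | e , j+e≡n = suc e , (s≤s z≤n , 1+e≤a) ,
                  perm-first a b c 1+e≤a (trans regroup (cong (_+ 1) j+e≡n))
  where
  regroup : suc e + j ≡ j + e + 1
  regroup = solve (e ∷ j ∷ [])
  n≡[b+c]+a : a + b + c ≡ b + c + a
  n≡[b+c]+a = solve (a ∷ b ∷ c ∷ [])
  1+e≤a : suc e ≤ a
  1+e≤a = gap b+c<j (trans j+e≡n n≡[b+c]+a)

-- From the image n + 1 - s of a point s of the first block, the next step
-- lands on rot b c s:  s + b when s ≤ c (last block), s - c when c < s
-- (middle block).  Here a = s + d.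
mirror-return : ∀ {b c} s d → suc (s + d) ≡ b + c →
                tripleperm (s + d) b c (suc (d + b + c)) ≡ rot b c s
mirror-return {b} {c} s d N≡b+c with ≤-or-above s c
... | inj₁ s≤c with m≤n⇒∃[o]m+o≡n s≤c
...   | e , refl = trans (perm-last (s + d) b (s + e) (≤-by-sum e past-middle) lands)
                       (sym (rot-low s≤c))
  where
  past-middle : suc (s + d + b) + e ≡ suc (d + b + (s + e))
  past-middle = solve (s ∷ d ∷ b ∷ e ∷ [])
  lands : suc (d + b + (s + e)) + (s + b) ≡ s + d + b + (s + e) + b + 1
  lands = solve (s ∷ d ∷ b ∷ e ∷ [])
mirror-return {b} {c} _ d N≡b+c | inj₂ (k , refl)
  with +-cancelʳ-≡ c (suc (suc (k + d))) b (trans regroup N≡b+c)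
  where
  -- N = b + c pins down b = k + d + 2.
  regroup : suc (suc (k + d)) + c ≡ suc (c + suc k + d)
  regroup = solve (k ∷ d ∷ c ∷ [])
... | refl = trans (perm-middle (c + suc k + d) b c
                                (≤-by-sum (suc d) past-first) (≤-by-sum k within-middle) lands)
                   (sym (rot-high b c k))
  where
  past-first : suc (c + suc k + d) + suc d ≡ suc (d + suc (suc (k + d)) + c)
  past-first = solve (c ∷ k ∷ d ∷ [])
  within-middle : suc (d + suc (suc (k + d)) + c) + k ≡ c + suc k + d + suc (suc (k + d))
  within-middle = solve (c ∷ k ∷ d ∷ [])
  lands : suc (d + suc (suc (k + d)) + c) + suc k ≡ c + suc k + d + suc (suc (k + d)) + 1
  lands = solve (c ∷ k ∷ d ∷ [])

return-at-top : ∀ {a b c} → suc a ≡ b + c → 1 ≤ b →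
                Reaches (tripleperm a b c) (suc a) (rot b c (suc a))
return-at-top {a} {suc b'} {c} N≡b+c (s≤s z≤n) = 1 , (begin
    tripleperm a (suc b') c (suc a)
      ≡⟨ perm-middle a (suc b') c (n<1+n a) (≤-by-sum b' within-middle) lands ⟩
    suc b'                          ≡⟨ rot-top b' c ⟨
    rot (suc b') c (suc b' + c)     ≡⟨ cong (rot (suc b') c) N≡b+c ⟨
    rot (suc b') c (suc a)          ∎)
  where
  open ≡-Reasoning
  within-middle : suc a + b' ≡ a + suc b'
  within-middle = solve (a ∷ b' ∷ [])
  lands : suc a + suc b' ≡ a + suc b' + 1
  lands = solve (a ∷ b' ∷ [])

first-return : ∀ {a b c} → suc a ≡ b + c → 1 ≤ b →
               ∀ s → InRange (suc a) s → Reaches (tripleperm a b c) s (rot b c s)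
first-return {a} {b} {c} N≡b+c 1≤b s (_ , s≤N) with m≤n⇒m<n∨m≡n s≤N
... | inj₂ refl = return-at-top N≡b+c 1≤b
... | inj₁ (s≤s s≤a) with m≤n⇒∃[o]m+o≡n s≤a
...   | d , refl =
  2 , trans (cong (tripleperm (s + d) b c) (perm-first (s + d) b c (m≤m+n s d) mirror))
            (mirror-return s d N≡b+c)
  where
  mirror : s + suc (d + b + c) ≡ s + d + b + c + 1
  mirror = solve (s ∷ d ∷ b ∷ c ∷ [])

window-entered : ∀ {a b c} → suc a ≡ b + c → ∀ i → 1 ≤ i → i ≤ a + b + c →
                 ∃ λ s → InRange (suc a) s × Reaches (tripleperm a b c) i s
window-entered {a} {b} {c} N≡b+c i 1≤i i≤n with i ≤? suc a
... | yes i≤N = i , (1≤i , i≤N) , reaches-refl _ i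
... | no i≰N = tripleperm a b c i , f-i∈window , reaches-step _ i
  where
  f-i∈window : InRange (suc a) (tripleperm a b c i)
  f-i∈window = subst (λ N → InRange N (tripleperm a b c i)) (sym N≡b+c)
                     (tail-lands (<-trans (n<1+n a) (≰⇒> i≰N)) i≤n)

window-left : ∀ {a b c} → suc a ≡ b + c → ∀ j → 1 ≤ j → j ≤ a + b + c →
              ∃ λ s → InRange (suc a) s × Reaches (tripleperm a b c) s j
window-left {a} {b} {c} N≡b+c j 1≤j j≤n with j ≤? suc a
... | yes j≤N = j , (1≤j , j≤N) , reaches-refl _ j
... | no j≰N with head-covers (subst (_< j) N≡b+c (≰⇒> j≰N)) j≤n
...   | s , (1≤s , s≤a) , f-s≡j = s , (1≤s , ≤-trans s≤a (n≤1+n a)) , (1 , f-s≡j)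

good-triple : ∀ {a b c} → suc a ≡ b + c → 1 ≤ b → Coprime b c → Good a b c
good-triple {a} {b} {c} N≡b+c 1≤b cop =
  single-cycle-criterion (a + b + c) (tripleperm a b c) (InRange (suc a))
    (window-entered N≡b+c) (window-left N≡b+c) connected
  where
  open Rotation {a} {b} {c} N≡b+c using (rot-range; rot-transitive)
  open Simulation (tripleperm a b c) (rot b c) (InRange (suc a))
                  rot-range (first-return N≡b+c 1≤b) using (simulate)
  connected : ∀ s t → InRange (suc a) s → InRange (suc a) t → Reaches (tripleperm a b c) s t
  connected s t s∈ t∈ = simulate s t s∈ (rot-transitive cop s t s∈ t∈)

theorem12 : ∀ (a b c : ℕ) → 0 < a → 0 < b → 0 < c →
            a ≡ b + c ∸ 1 → c ≤ a → b ≤ c → Coprime b c →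
            Good a b c
theorem12 a b c _ 0<b _ a≡b+c-1 _ _ cop = good-triple N≡b+c 0<b cop
  where
  -- b + c ≥ 1, so the truncated subtraction in the hypothesis is exact.
  N≡b+c : suc a ≡ b + c
  N≡b+c = trans (cong suc a≡b+c-1) (m+[n∸m]≡n (≤-trans 0<b (m≤m+n b c)))
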